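{- Let $m,n$ be positive integers and let $\Pi$ be an $(m,n)$-Dyck path. Then $\operatorname{maxtdinv}(\Pi)=\operatorname{tdinv}(\mathrm{PF})$, where $\mathrm{PF}$ is the $(m,n)$-parking function supported by $\Pi$ whose word is $\sigma(\mathrm{PF})=n\,(n-1)\cdots 2\,1$. In particular, $$\operatorname{maxtdinv}(\Pi)=\sum_{c,c'}\chi\big(\operatorname{rank}(c)<\operatorname{rank}(c')<\operatorname{rank}(c)+m\big),$$ where the sum runs over ordered pairs $(c,c')$ of parking spaces of $\Pi$.
   Context: An $(m,n)$-Dyck path is a lattice path from $(0,0)$ to $(m,n)$ with unit north and east steps staying weakly above the line $y=\frac{n}{m}x$. A parking space of $\Pi$ is a unit cell immediately east of a north step of $\Pi$. If the north step goes from $(x,y)$ to $(x,y+1)$, the parking space is the cell with southwest corner $(x,y)$. An $(m,n)$-parking function $\mathrm{PF}$ supported by $\Pi$ is a labeling of the $n$ parking spaces of $\Pi$ by $1,\dots,n$ (the "cars"), each used once, such that labels increase from bottom to top within each column. Define $\operatorname{rank}(x,y)=my-nx+\lfloor x\gcd(m,n)/m\rfloor$. The rank of a cell (or of the car in it) is the rank of its southwest corner. The word $\sigma(\mathrm{PF})$ lists the cars in decreasing order of rank. The temporary dinv is $$\operatorname{tdinv}(\mathrm{PF})=\#\{\text{cars } i<j : \operatorname{rank}(i)<\operatorname{rank}(j)<\operatorname{rank}(i)+m\},$$ and $\operatorname{maxtdinv}(\Pi)=\max\{\operatorname{tdinv}(\mathrm{PF}) : \mathrm{PF}\text{ supported by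 }\Pi\}$. -}

module Defs where

open import Data.Nat as ℕ using (ℕ; zero; suc; _≤_; _<_)
open import Data.Nat.DivMod using (_/_)
open import Data.Nat.GCD using (gcd)
open import Data.Integer as ℤ using (ℤ; +_)
open import Data.Bool using (Bool; true; false; if_then_else_; _∧_)
open import Data.Product using (_×_; _,_; proj₁; proj₂; ∃)
open import Data.List using (List; []; _∷_; map; downFrom)
open import Data.Nat.ListAction using (sum)
open import Data.List.Relation.Unary.All using (All)
open import Data.List.Relation.Unary.AllPairs using (AllPairs)
open import Data.List.Relation.Binary.Permutation.Propositional using (_↭_)
open import Relation.Nullary.Decidable using (does)
open import Relation.Binary.PropositionalEquality using (_≡_)

data Step : Set where
  N E : Step

Path : Set
Path = List Step

-- A lattice point / the southwest corner of a unit cell.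
Point : Set
Point = ℕ × ℕ

pointsFrom : ℕ → ℕ → Path → List Point
pointsFrom x y []      = (x , y) ∷ []
pointsFrom x y (N ∷ s) = (x , y) ∷ pointsFrom x (suc y) s
pointsFrom x y (E ∷ s) = (x , y) ∷ pointsFrom (suc x) y s

endFrom : ℕ → ℕ → Path → Point
endFrom x y []      = (x , y)
endFrom x y (N ∷ s) = endFrom x (suc y) s
endFrom x y (E ∷ s) = endFrom (suc x) y s

IsDyck : ℕ → ℕ → Path → Set
IsDyck m n Π =
  endFrom 0 0 Π ≡ (m , n) × All (λ p → n ℕ.* proj₁ p ≤ m ℕ.* proj₂ p) (pointsFrom 0 0 Π)

-- Parking spaces: for a north step from (x,y) to (x,y+1), the cell with
-- southwest corner (x,y); listed in path order (bottom to top).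
cellsFrom : ℕ → ℕ → Path → List Point
cellsFrom x y []      = []
cellsFrom x y (N ∷ s) = (x , y) ∷ cellsFrom x (suc y) s
cellsFrom x y (E ∷ s) = cellsFrom (suc x) y s

parkingSpaces : Path → List Point
parkingSpaces Π = cellsFrom 0 0 Π

-- floor (a / b); junk value 0 when b = 0 (never used: m > 0).
floorDiv : ℕ → ℕ → ℕ
floorDiv a zero    = 0
floorDiv a (suc b) = a / suc b

rank : ℕ → ℕ → Point → ℤ
rank m n (x , y) =
  (+ (m ℕ.* y) ℤ.- + (n ℕ.* x)) ℤ.+ + floorDiv (x ℕ.* gcd m n) m

-- A labelled cell: (cell , car).
LCell : Set
LCell = Point × ℕ

IsPF : ℕ → Path → List LCell → Set
IsPF n Π PF =
  map proj₁ PF ≡ parkingSpaces Π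
  × map proj₂ PF ↭ map suc (downFrom n)
  × AllPairs (λ a b → proj₁ (proj₁ a) ≡ proj₁ (proj₁ b) → proj₂ a < proj₂ b) PF

χ : Bool → ℕ
χ b = if b then 1 else 0

rankWindow : ℕ → ℕ → Point → Point → Bool
rankWindow m n a b =
  does (rank m n a ℤ.<? rank m n b) ∧ does (rank m n b ℤ.<? rank m n a ℤ.+ + m)

pairSum : {A : Set} → (A → A → ℕ) → List A → ℕ
pairSum f L = sum (map (λ a → sum (map (λ b → f a b) L)) L)

tdinv : ℕ → ℕ → List LCell → ℕ
tdinv m n PF =
  pairSum (λ a b → χ (does (proj₂ a ℕ.<? proj₂ b) ∧ rankWindow m n (proj₁ a) (proj₁ b))) PF

insertByRank : ℕ → ℕ → LCell → List LCell → List LCell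
insertByRank m n c [] = c ∷ []
insertByRank m n c (d ∷ ds) =
  if does (rank m n (proj₁ d) ℤ.≤? rank m n (proj₁ c))
  then c ∷ d ∷ ds
  else d ∷ insertByRank m n c ds

sortByRankDesc : ℕ → ℕ → List LCell → List LCell
sortByRankDesc m n []       = []
sortByRankDesc m n (c ∷ cs) = insertByRank m n c (sortByRankDesc m n cs)

word : ℕ → ℕ → List LCell → List ℕ
word m n PF = map proj₂ (sortByRankDesc m n PF)

IsMaxTdinv : ℕ → ℕ → Path → ℕ → Set
IsMaxTdinv m n Π k =
  (∃ λ PF → IsPF n Π PF × tdinv m n PF ≡ k)
  × (∀ PF → IsPF n Π PF → tdinv m n PF ≤ k)

rankPairSum : ℕ → ℕ → Path → ℕ
rankPairSum m n Π = pairSum (λ c c' → χ (rankWindow m n c c')) (parkingSpaces Π)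

module Submission where

-- Forgetting the condition "car i < car j" in tdinv can only
-- increase the count, so tdinv(PF) ≤ Σ_{(c,c')} χ(rank c < rank c' < rank c + m)
-- for every PF supported by Π.  If the word σ(PF) is strictly decreasing, then
-- a cell of larger rank carries a larger car, so that condition is implied by
-- the rank window and tdinv(PF) equals the sum; hence it is the maximum.
-- It remains to see that the labelling with word n⋯21 exists and is a parking
-- function: insertion sort places each cell at a position that depends only
-- on the cells, so every word of the right length is realised by some
-- labelling; and within a column rank strictly increases upwards (as m > 0),
-- so the decreasing word makes cars increase upwards.

open import Defs
open import Data.Nat using (ℕ; suc; _<_)
open import Data.List using (map; downFrom)
open import Data.Product using (_×_; ∃)
open import Relation.Binary.PropositionalEquality using (_≡_)

open import Data.Nat as ℕ using (zero; _≤_; _>_; z≤n; s≤s; NonZero)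
import Data.Nat.Properties as ℕP
open import Data.Nat.GCD using (gcd)
open import Data.Integer as ℤ using (+_)
import Data.Integer.Properties as ℤP
open import Data.Bool using (Bool; true; false; T; _∧_)
open import Data.Bool.Properties using (T-∧)
open import Data.Product using (_,_; proj₁; proj₂; Σ)
open import Data.Sum using (_⊎_; inj₁; inj₂)
open import Data.Empty using (⊥-elim)
open import Data.List using (List; []; _∷_; _++_; length)
open import Data.List.Properties
  using (∷-injective; length-++-sucʳ; length-map; map-∘; length-downFrom; map-downFrom)
open import Data.Nat.ListAction using (sum)
open import Data.List.Relation.Unary.All as All using (All; []; _∷_)
open import Data.List.Relation.Unary.Any using (here; there)
open import Data.List.Relation.Unary.AllPairs as AllPairs using (AllPairs; []; _∷_)
import Data.List.Relation.Unary.AllPairs.Properties as AllPairsP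
open import Data.List.Membership.Propositional using (_∈_)
open import Data.List.Relation.Binary.Permutation.Propositional
  using (_↭_; refl; prep; swap; trans; ↭-sym)
import Data.List.Relation.Binary.Permutation.Propositional.Properties as ↭P
open import Function using (Equivalence)
open import Relation.Nullary using (Dec; yes; no)
open import Relation.Nullary.Decidable using (does)
open import Relation.Binary.PropositionalEquality
  using (refl; sym; cong; cong₂; subst; module ≡-Reasoning)
  renaming (trans to ≡-trans)

allPairs-trichotomy : {A : Set} {R : A → A → Set} {L : List A} → AllPairs R L →
  ∀ {a b} → a ∈ L → b ∈ L → a ≡ b ⊎ R a b ⊎ R b a
allPairs-trichotomy (_ ∷ _)  (here refl) (here refl) = inj₁ refl
allPairs-trichotomy (Ra ∷ _) (here refl) (there b∈) = inj₂ (inj₁ (All.lookup Ra b∈))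
allPairs-trichotomy (Rb ∷ _) (there a∈) (here refl) = inj₂ (inj₂ (All.lookup Rb a∈))
allPairs-trichotomy (_ ∷ R*) (there a∈) (there b∈) = allPairs-trichotomy R* a∈ b∈

allPairs-map∈ : {A : Set} {P Q : A → A → Set} {L : List A} →
  (∀ {a b} → a ∈ L → b ∈ L → P a b → Q a b) → AllPairs P L → AllPairs Q L
allPairs-map∈ f [] = []
allPairs-map∈ f (Pa ∷ P*) =
  All.tabulate (λ b∈ → f (here refl) (there b∈) (All.lookup Pa b∈))
  ∷ allPairs-map∈ (λ a∈ b∈ → f (there a∈) (there b∈)) P*

splitAt-index : (T : List ℕ) (p : ℕ) → p < length T →
  Σ (List ℕ) λ A → Σ ℕ λ t → Σ (List ℕ) λ B → T ≡ A ++ t ∷ B × length A ≡ p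
splitAt-index (t ∷ T) zero    _         = [] , t , T , refl , refl
splitAt-index (x ∷ T) (suc p) (s≤s p<) with splitAt-index T p p<
... | A , t , B , refl , refl = x ∷ A , t , B , refl , refl

sum-map-cong : {A : Set} (f g : A → ℕ) (L : List A) →
  (∀ {a} → a ∈ L → f a ≡ g a) → sum (map f L) ≡ sum (map g L)
sum-map-cong f g []      _ = refl
sum-map-cong f g (x ∷ L) h =
  cong₂ ℕ._+_ (h (here refl)) (sum-map-cong f g L (λ a∈ → h (there a∈)))

sum-map-mono : {A : Set} (f g : A → ℕ) (L : List A) →
  (∀ a → f a ≤ g a) → sum (map f L) ≤ sum (map g L)
sum-map-mono f g []      _ = z≤n
sum-map-mono f g (x ∷ L) h = ℕP.+-mono-≤ (h x) (sum-map-mono f g L h)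

pairSum-cong : {A : Set} (f g : A → A → ℕ) (L : List A) →
  (∀ {a b} → a ∈ L → b ∈ L → f a b ≡ g a b) → pairSum f L ≡ pairSum g L
pairSum-cong f g L h =
  sum-map-cong _ _ L (λ a∈ → sum-map-cong _ _ L (λ b∈ → h a∈ b∈))

pairSum-mono : {A : Set} (f g : A → A → ℕ) (L : List A) →
  (∀ a b → f a b ≤ g a b) → pairSum f L ≤ pairSum g L
pairSum-mono f g L h = sum-map-mono _ _ L (λ a → sum-map-mono _ _ L (λ b → h a b))

pairSum-map : {A B : Set} (f : B → B → ℕ) (h : A → B) (L : List A) →
  pairSum f (map h L) ≡ pairSum (λ a b → f (h a) (h b)) L
pairSum-map f h L = begin
  sum (map (λ b → sum (map (f b) (map h L))) (map h L))
    ≡⟨ cong sum (sym (map-∘ L)) ⟩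
  sum (map (λ a → sum (map (f (h a)) (map h L))) L)
    ≡⟨ sum-map-cong _ _ L (λ {a} _ → cong sum (sym (map-∘ L))) ⟩
  sum (map (λ a → sum (map (λ b → f (h a) (h b)) L)) L) ∎
  where open ≡-Reasoning

χ-∧-≤ : ∀ b w → χ (b ∧ w) ≤ χ w
χ-∧-≤ true  w = ℕP.≤-refl
χ-∧-≤ false w = z≤n

does-elim : {P : Set} (d : Dec P) → T (does d) → P
does-elim (yes p) _ = p

does-intro : {P : Set} (d : Dec P) → P → T (does d)
does-intro (yes _) _ = _
does-intro (no ¬p) p = ¬p p

χ-∧-implied : ∀ b w → (T w → T b) → χ (b ∧ w) ≡ χ w
χ-∧-implied true  w     _ = refl
χ-∧-implied false false _ = refl
χ-∧-implied false true  h = ⊥-elim (h _)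

module RankSort (m n : ℕ) where

  rk : Point → ℤ.ℤ
  rk = rank m n

  RankSorted : List LCell → Set
  RankSorted = AllPairs (λ a b → rk (proj₁ b) ℤ.≤ rk (proj₁ a))

  insert-↭ : ∀ c D → insertByRank m n c D ↭ c ∷ D
  insert-↭ c []       = refl
  insert-↭ c (d ∷ ds) with rk (proj₁ d) ℤ.≤? rk (proj₁ c)
  ... | yes _ = refl
  ... | no  _ = trans (prep d (insert-↭ c ds)) (swap d c refl)

  sort-↭ : ∀ X → sortByRankDesc m n X ↭ X
  sort-↭ []       = refl
  sort-↭ (c ∷ cs) = trans (insert-↭ c (sortByRankDesc m n cs)) (prep c (sort-↭ cs))

  insert-sorted : ∀ c D → RankSorted D → RankSorted (insertByRank m n c D)
  insert-sorted c []       _         = [] ∷ []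
  insert-sorted c (d ∷ ds) (d≥ ∷ s) with rk (proj₁ d) ℤ.≤? rk (proj₁ c)
  ... | yes d≤c = (d≤c ∷ All.map (λ e≤d → ℤP.≤-trans e≤d d≤c) d≥) ∷ d≥ ∷ s
  ... | no  d≰c =
    ↭P.All-resp-↭ (↭-sym (insert-↭ c ds)) (ℤP.<⇒≤ (ℤP.≰⇒> d≰c) ∷ d≥)
    ∷ insert-sorted c ds s

  sort-sorted : ∀ X → RankSorted (sortByRankDesc m n X)
  sort-sorted []       = []
  sort-sorted (c ∷ cs) = insert-sorted c _ (sort-sorted cs)

  insertPos : Point → List Point → ℕ
  insertPos c []       = 0
  insertPos c (d ∷ ds) with rk d ℤ.≤? rk c
  ... | yes _ = 0
  ... | no  _ = suc (insertPos c ds)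

  insertCell : Point → List Point → List Point
  insertCell c []       = c ∷ []
  insertCell c (d ∷ ds) with rk d ℤ.≤? rk c
  ... | yes _ = c ∷ d ∷ ds
  ... | no  _ = d ∷ insertCell c ds

  sortCells : List Point → List Point
  sortCells []       = []
  sortCells (c ∷ cs) = insertCell c (sortCells cs)

  insertPos≤length : ∀ c D → insertPos c D ≤ length D
  insertPos≤length c []       = z≤n
  insertPos≤length c (d ∷ ds) with rk d ℤ.≤? rk c
  ... | yes _ = z≤n
  ... | no  _ = s≤s (insertPos≤length c ds)

  insertPos<length : ∀ c cs → insertPos c (sortCells cs) < suc (length cs)
  insertPos<length c cs = s≤s (subst (insertPos c (sortCells cs) ≤_) (length-sortCells cs)
                                     (insertPos≤length c (sortCells cs)))
    where
    length-sortCells : ∀ L → length (sortCells L) ≡ length L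
    length-sortCells []       = refl
    length-sortCells (c ∷ cs) =
      ≡-trans (length-insertCell c (sortCells cs)) (cong suc (length-sortCells cs))
      where
      length-insertCell : ∀ c D → length (insertCell c D) ≡ suc (length D)
      length-insertCell c []       = refl
      length-insertCell c (d ∷ ds) with rk d ℤ.≤? rk c
      ... | yes _ = refl
      ... | no  _ = cong suc (length-insertCell c ds)

  -- Sorting commutes with forgetting the cars: the order of the cells does
  -- not depend on the labelling.
  insert-cells : ∀ c D → map proj₁ (insertByRank m n c D) ≡ insertCell (proj₁ c) (map proj₁ D)
  insert-cells c []       = refl
  insert-cells c (d ∷ ds) with rk (proj₁ d) ℤ.≤? rk (proj₁ c)
  ... | yes _ = refl
  ... | no  _ = cong (proj₁ d ∷_) (insert-cells c ds)

  sort-cells : ∀ X → map proj₁ (sortByRankDesc m n X) ≡ sortCells (map proj₁ X)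
  sort-cells []       = refl
  sort-cells (c ∷ cs) = ≡-trans (insert-cells c (sortByRankDesc m n cs))
                                (cong (insertCell (proj₁ c)) (sort-cells cs))

  insert-cars : ∀ c t S A B → insertPos c (map proj₁ S) ≡ length A →
    map proj₂ S ≡ A ++ B → map proj₂ (insertByRank m n (c , t) S) ≡ A ++ t ∷ B
  insert-cars c t []      []      B _ cars = cong (t ∷_) cars
  insert-cars c t (d ∷ S) A       B pos cars with rk (proj₁ d) ℤ.≤? rk c
  insert-cars c t (d ∷ S) []      B pos     cars | yes _ = cong (t ∷_) cars
  insert-cars c t (d ∷ S) (a ∷ A) B ()      cars | yes _
  insert-cars c t (d ∷ S) []      B ()      cars | no  _
  insert-cars c t (d ∷ S) (a ∷ A) B pos     cars | no  _ =
    cong₂ _∷_ (proj₁ (∷-injective cars))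
              (insert-cars c t S A B (ℕP.suc-injective pos) (proj₂ (∷-injective cars)))

  realise : ∀ (L : List Point) (T : List ℕ) → length T ≡ length L →
    Σ (List LCell) λ PF → map proj₁ PF ≡ L × word m n PF ≡ T
  realise []       []      _   = [] , refl , refl
  realise []       (_ ∷ _) ()
  realise (c ∷ cs) T       len
    with splitAt-index T (insertPos c (sortCells cs)) (subst (_ <_) (sym len) (insertPos<length c cs))
  ... | A , t , B , refl , |A|≡pos
      with realise cs (A ++ B) (ℕP.suc-injective (≡-trans (sym (length-++-sucʳ A t B)) len))
  ... | PF , cells , cars = (c , t) ∷ PF , cong (c ∷_) cells ,
        insert-cars c t (sortByRankDesc m n PF) A B pos cars
    where
    pos : insertPos c (map proj₁ (sortByRankDesc m n PF)) ≡ length A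
    pos = ≡-trans (cong (insertPos c) (≡-trans (sort-cells PF) (cong sortCells cells)))
                  (sym |A|≡pos)

  ∈-sorted : ∀ PF {x} → x ∈ PF → x ∈ sortByRankDesc m n PF
  ∈-sorted PF = ↭P.∈-resp-↭ (↭-sym (sort-↭ PF))

  rank-order⇒car-order : ∀ PF → AllPairs _>_ (word m n PF) →
    ∀ {a b} → a ∈ PF → b ∈ PF → rk (proj₁ a) ℤ.< rk (proj₁ b) → proj₂ a < proj₂ b
  rank-order⇒car-order PF decreasing a∈ b∈ a<b
    with allPairs-trichotomy (AllPairs.zip (sort-sorted PF , AllPairsP.map⁻ decreasing))
                             (∈-sorted PF a∈) (∈-sorted PF b∈)
  ... | inj₁ refl             = ⊥-elim (ℤP.<-irrefl refl a<b)
  ... | inj₂ (inj₁ (b≤a , _)) = ⊥-elim (ℤP.<-irrefl refl (ℤP.<-≤-trans a<b b≤a))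
  ... | inj₂ (inj₂ (_ , a<b)) = a<b

module TdinvBounds (m n : ℕ) where
  open RankSort m n

  -- The cell of a labelled cell (proj₁ at a fixed type, to guide inference).
  cellOf : LCell → Point
  cellOf = proj₁

  windowCount : Point → Point → ℕ
  windowCount c c' = χ (rankWindow m n c c')

  carCondition : LCell → LCell → Bool
  carCondition a b = does (proj₂ a ℕ.<? proj₂ b)

  rankPairSum-labelled : ∀ Π PF → map proj₁ PF ≡ parkingSpaces Π →
    rankPairSum m n Π ≡ pairSum (λ a b → windowCount (proj₁ a) (proj₁ b)) PF
  rankPairSum-labelled Π PF cells =
    ≡-trans (cong (pairSum windowCount) (sym cells)) (pairSum-map windowCount cellOf PF)

  tdinvCount : LCell → LCell → ℕ
  tdinvCount a b = χ (carCondition a b ∧ rankWindow m n (proj₁ a) (proj₁ b))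

  -- Dropping the condition "car a < car b" can only increase the count.
  tdinv≤rankPairSum : ∀ Π PF → map proj₁ PF ≡ parkingSpaces Π →
    tdinv m n PF ≤ rankPairSum m n Π
  tdinv≤rankPairSum Π PF cells =
    subst (tdinv m n PF ≤_) (sym (rankPairSum-labelled Π PF cells))
      (pairSum-mono tdinvCount (λ a b → windowCount (proj₁ a) (proj₁ b)) PF
        (λ a b → χ-∧-≤ (carCondition a b) (rankWindow m n (proj₁ a) (proj₁ b))))

  -- For a strictly decreasing word that condition is implied by the rank window.
  tdinv-decreasing : ∀ Π PF → map proj₁ PF ≡ parkingSpaces Π → AllPairs _>_ (word m n PF) →
    tdinv m n PF ≡ rankPairSum m n Π
  tdinv-decreasing Π PF cells decreasing =
    ≡-trans (pairSum-cong tdinvCount (λ a b → windowCount (proj₁ a) (proj₁ b)) PF implied)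
            (sym (rankPairSum-labelled Π PF cells))
    where
    implied : ∀ {a b} → a ∈ PF → b ∈ PF → tdinvCount a b ≡ windowCount (proj₁ a) (proj₁ b)
    implied {a} {b} a∈ b∈ =
      χ-∧-implied (carCondition a b) (rankWindow m n (proj₁ a) (proj₁ b)) λ inWindow →
        does-intro (proj₂ a ℕ.<? proj₂ b) (rank-order⇒car-order PF decreasing a∈ b∈
          (does-elim (rk (proj₁ a) ℤ.<? rk (proj₁ b)) (proj₁ (Equivalence.to T-∧ inWindow))))

cells-above : ∀ x y s → All (λ c → y ≤ proj₂ c) (cellsFrom x y s)
cells-above x y []      = []
cells-above x y (N ∷ s) = ℕP.≤-refl ∷ All.map ℕP.<⇒≤ (cells-above x (suc y) s)
cells-above x y (E ∷ s) = cells-above (suc x) y s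

SameColumn⇒Below : Point → Point → Set
SameColumn⇒Below c c' = proj₁ c ≡ proj₁ c' → proj₂ c < proj₂ c'

cells-columns : ∀ x y s → AllPairs SameColumn⇒Below (cellsFrom x y s)
cells-columns x y []      = []
cells-columns x y (N ∷ s) = All.map (λ above _ → above) (cells-above x (suc y) s)
                            ∷ cells-columns x (suc y) s
cells-columns x y (E ∷ s) = cells-columns (suc x) y s

length-cells : ∀ x y s → length (cellsFrom x y s) ℕ.+ y ≡ proj₂ (endFrom x y s)
length-cells x y []      = refl
length-cells x y (N ∷ s) =
  ≡-trans (sym (ℕP.+-suc (length (cellsFrom x (suc y) s)) y)) (length-cells x (suc y) s)
length-cells x y (E ∷ s) = length-cells (suc x) y s

dyck-length-cells : ∀ m n Π → IsDyck m n Π → length (parkingSpaces Π) ≡ n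
dyck-length-cells m n Π (ends , _) =
  ≡-trans (sym (ℕP.+-identityʳ _)) (≡-trans (length-cells 0 0 Π) (cong proj₂ ends))

rank-up-column : ∀ m n .{{_ : NonZero m}} (c c' : Point) →
  SameColumn⇒Below c c' → proj₁ c ≡ proj₁ c' → rank m n c ℤ.< rank m n c'
rank-up-column m n (x , y) (.x , y') below refl =
  ℤP.+-monoˡ-< (+ floorDiv (x ℕ.* gcd m n) m)
    (ℤP.+-monoˡ-< (ℤ.- (+ (n ℕ.* x))) (ℤ.+<+ (ℕP.*-monoʳ-< m (below refl))))

decreasing⇒columns : ∀ m n .{{_ : NonZero m}} Π PF → map proj₁ PF ≡ parkingSpaces Π →
  AllPairs _>_ (word m n PF) →
  AllPairs (λ a b → proj₁ (proj₁ a) ≡ proj₁ (proj₁ b) → proj₂ a < proj₂ b) PF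
decreasing⇒columns m n Π PF cells decreasing =
  allPairs-map∈ (λ {a} {b} a∈ b∈ below sameColumn →
      rank-order⇒car-order PF decreasing a∈ b∈
        (rank-up-column m n (proj₁ a) (proj₁ b) below sameColumn))
    (AllPairsP.map⁻ (subst (AllPairs SameColumn⇒Below) (sym cells) (cells-columns 0 0 Π)))
  where open RankSort m n

decreasing-target : ∀ n → AllPairs _>_ (map suc (downFrom n))
decreasing-target n = subst (AllPairs _>_) (sym (map-downFrom suc n))
  (AllPairsP.applyDownFrom⁺₁ suc n (λ j<i _ → s≤s j<i))

lemma1 : (m n : ℕ) (Π : Path) → 0 < m → 0 < n → IsDyck m n Π →
    (∃ λ PF → IsPF n Π PF × word m n PF ≡ map suc (downFrom n))
    × (∀ PF → IsPF n Π PF → word m n PF ≡ map suc (downFrom n) →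
         IsMaxTdinv m n Π (tdinv m n PF) × tdinv m n PF ≡ rankPairSum m n Π)
lemma1 m@(suc _) n Π _ _ dyck = existence , maximality
  where
  open RankSort m n
  open TdinvBounds m n

  target : List ℕ
  target = map suc (downFrom n)

  decreasing : ∀ PF → word m n PF ≡ target → AllPairs _>_ (word m n PF)
  decreasing PF wordPF = subst (AllPairs _>_) (sym wordPF) (decreasing-target n)

  existence : ∃ λ PF → IsPF n Π PF × word m n PF ≡ target
  existence with realise (parkingSpaces Π) target
                   (≡-trans (length-map suc (downFrom n))
                   (≡-trans (length-downFrom n) (sym (dyck-length-cells m n Π dyck))))
  ... | PF , cells , wordPF =
    PF , (cells , cars , columns) , wordPF
    where
    cars : map proj₂ PF ↭ target
    cars = subst (map proj₂ PF ↭_) wordPF (↭P.map⁺ proj₂ (↭-sym (sort-↭ PF)))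
    columns : AllPairs (λ a b → proj₁ (proj₁ a) ≡ proj₁ (proj₁ b) → proj₂ a < proj₂ b) PF
    columns = decreasing⇒columns m n Π PF cells (decreasing PF wordPF)

  maximality : ∀ PF → IsPF n Π PF → word m n PF ≡ target →
    IsMaxTdinv m n Π (tdinv m n PF) × tdinv m n PF ≡ rankPairSum m n Π
  maximality PF isPF@(cells , _) wordPF =
    ((PF , isPF , refl) , λ Q (cellsQ , _) →
        subst (tdinv m n Q ≤_) (sym attains) (tdinv≤rankPairSum Π Q cellsQ))
    , attains
    where
    attains : tdinv m n PF ≡ rankPairSum m n Π
    attains = tdinv-decreasing Π PF cells (decreasing PF wordPF)
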